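{- Let $\ell$ be an odd positive integer with $\ell \equiv 0 \pmod 3$ and let $m = \ell/3$. Suppose $A=[a_1,\ldots,a_\ell]$ and $B=[b_1,\ldots,b_\ell]$ form a Legendre pair of length $\ell$. Define $$A_1=\sum_{i=0}^{m-1}a_{3i+1},\quad A_2=\sum_{i=0}^{m-1}a_{3i+2},\quad A_3=\sum_{i=0}^{m-1}a_{3i+3},$$ $$B_1=\sum_{i=0}^{m-1}b_{3i+1},\quad B_2=\sum_{i=0}^{m-1}b_{3i+2},\quad B_3=\sum_{i=0}^{m-1}b_{3i+3}.$$ Then $$\operatorname{PSD}(A,m)=\tfrac{3}{2}\left(A_1^2+A_2^2+A_3^2\right)-\tfrac12,\qquad \operatorname{PSD}(B,m)=\tfrac{3}{2}\left(B_1^2+B_2^2+B_3^2\right)-\tfrac12,$$ and $$A_1^2+A_2^2+A_3^2+B_1^2+B_2^2+B_3^2=4m+2.$$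
   Context: For a sequence $A=[a_1,\ldots,a_\ell]$ of real numbers, the periodic autocorrelation function is $\operatorname{PAF}(A,s)=\sum_{i=1}^{\ell}a_i a_{i+s}$ for $s=0,\ldots,\ell-1$, where indices are taken modulo $\ell$ (in $\{1,\ldots,\ell\}$). The discrete Fourier transform is $\operatorname{DFT}(A,s)=\sum_{i=1}^{\ell}a_i\,\omega^{s(i-1)}$ with $\omega=e^{2\pi i/\ell}$, and the power spectral density is $\operatorname{PSD}(A,s)=|\operatorname{DFT}(A,s)|^2$. For odd $\ell$, two sequences $A,B\in\{ -1,+1\}^\ell$ form a Legendre pair of length $\ell$ if $a_1+\cdots+a_\ell=b_1+\cdots+b_\ell=\pm1$ and $\operatorname{PAF}(A,s)+\operatorname{PAF}(B,s)=-2$ for all $s=1,\ldots,(\ell-1)/2$. -}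

module Defs where

open import Data.Nat as ℕ using (ℕ; zero; suc; NonZero; _%_)
open import Data.Nat.DivMod using (m%n<n)
open import Data.Fin using (Fin; toℕ; fromℕ<)
open import Data.Integer using (ℤ; +_; -_; _+_; _*_; _-_)
open import Data.Product using (_×_; _,_)
open import Data.Sum using (_⊎_)
open import Relation.Binary.PropositionalEquality using (_≡_)

-- A sequence of length ℓ is a function Fin ℓ → ℤ; entry i (0-based)
-- stands for the paper's a_{i+1}.
Seq : ℕ → Set
Seq ℓ = Fin ℓ → ℤ

IsPM1 : ∀ {ℓ} → Seq ℓ → Set
IsPM1 {ℓ} a = ∀ (i : Fin ℓ) → a i ≡ + 1 ⊎ a i ≡ - (+ 1)

sumℕ : ℕ → (ℕ → ℤ) → ℤ
sumℕ zero    f = + 0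
sumℕ (suc n) f = sumℕ n f + f n

idx : (ℓ : ℕ) .{{_ : NonZero ℓ}} → ℕ → Fin ℓ
idx ℓ k = fromℕ< (m%n<n k ℓ)

at : ∀ ℓ .{{_ : NonZero ℓ}} → Seq ℓ → ℕ → ℤ
at ℓ a k = a (idx ℓ k)

total : ∀ ℓ .{{_ : NonZero ℓ}} → Seq ℓ → ℤ
total ℓ a = sumℕ ℓ (at ℓ a)

PAF : ∀ ℓ .{{_ : NonZero ℓ}} → Seq ℓ → ℕ → ℤ
PAF ℓ a s = sumℕ ℓ (λ i → at ℓ a i * at ℓ a (i ℕ.+ s))

Odd : ℕ → Set
Odd ℓ = ℓ % 2 ≡ 1

LegendrePair : ∀ ℓ .{{_ : NonZero ℓ}} → Seq ℓ → Seq ℓ → Set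
LegendrePair ℓ a b =
  IsPM1 a × IsPM1 b ×
  total ℓ a ≡ total ℓ b ×
  (total ℓ a ≡ + 1 ⊎ total ℓ a ≡ - (+ 1)) ×
  (∀ (s : ℕ) → 1 ℕ.≤ s → s ℕ.≤ ℓ ℕ./ 2 → PAF ℓ a s + PAF ℓ b s ≡ - (+ 2))

-- Eisenstein integers ℤ[ζ], ζ = e^{2πi/3} (so ζ² = -1 - ζ).
-- The pair (x , y) denotes the complex number x + y ζ.
Eis : Set
Eis = ℤ × ℤ

_+ᴱ_ : Eis → Eis → Eis
(x , y) +ᴱ (u , v) = (x + u , y + v)

ζ^ : ℕ → Eis
ζ^ k with k % 3
... | 0 = (+ 1 , + 0)
... | 1 = (+ 0 , + 1)
... | _ = (- (+ 1) , - (+ 1))     -- ζ² = -1 - ζ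

scale : ℤ → Eis → Eis
scale c (x , y) = (c * x , c * y)

sumᴱ : ℕ → (ℕ → Eis) → Eis
sumᴱ zero    f = (+ 0 , + 0)
sumᴱ (suc n) f = sumᴱ n f +ᴱ f n

-- |x + y ζ|² = (x + yζ)(x + yζ̄) = x² - x y + y²
absSq : Eis → ℤ
absSq (x , y) = x * x - x * y + y * y

-- DFT(A, m) for ℓ = 3m: ω = e^{2πi/ℓ}, so ω^{m·k} = ζ^k with ζ = e^{2πi/3}.
-- DFT(A,m) = Σ_{k=0}^{ℓ-1} a_{k+1} ω^{m k} = Σ_k a_{k+1} ζ^{k mod 3}.
DFTm : ∀ ℓ .{{_ : NonZero ℓ}} → Seq ℓ → Eis
DFTm ℓ a = sumᴱ ℓ (λ k → scale (at ℓ a k) (ζ^ k))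

PSDm : ∀ ℓ .{{_ : NonZero ℓ}} → Seq ℓ → ℤ
PSDm ℓ a = absSq (DFTm ℓ a)

-- residue-class sums: X_j = Σ_{i=0}^{m-1} x_{3i+j}  (j = 1,2,3; 1-based)
classSum : ∀ ℓ .{{_ : NonZero ℓ}} → Seq ℓ → ℕ → ℕ → ℤ
classSum ℓ a m j = sumℕ m (λ i → at ℓ a (3 ℕ.* i ℕ.+ j ℕ.∸ 1))

sq : ℤ → ℤ
sq x = x * x

-- With ℓ = 3m, ω^m = ζ is a primitive cube root of unity, so DFT(A,m) = A₁ + A₂ζ + A₃ζ²,
-- and 2|A₁ + A₂ζ + A₃ζ²|² = 3(A₁² + A₂² + A₃²) − (A₁ + A₂ + A₃)² with A₁ + A₂ + A₃ = ±1.
-- Pairing each a_i with the sum of its own residue class mod 3 gives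
-- A₁² + A₂² + A₃² = Σ_{t<m} PAF(A,3t). Adding the same for B, the Legendre condition,
-- extended to all lags 1 ≤ s < ℓ by PAF(A,s) = PAF(A,ℓ−s), leaves 2ℓ − 2(m − 1) = 4m + 2.

module Submission where

open import Defs
open import Data.Nat as ℕ using (ℕ; NonZero; zero; suc; _/_; _≤_; _<_; _≤?_)
import Data.Nat.Properties as ℕP
open import Data.Nat.DivMod using ([m+n]%n≡m%n; m%n<n; m≡m%n+[m/n]*n; [m+kn]%n≡m%n; m*n/n≡m)
open import Data.Nat.Divisibility using (_∣_; divides)
import Data.Nat.Tactic.RingSolver as ℕSolver
open import Data.Integer using (ℤ; +_; -_; _+_; _*_; _-_)
import Data.Integer.Properties as ℤP
open import Data.Integer.Tactic.RingSolver using (solve-∀)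
open import Algebra.Properties.AbelianGroup ℤP.+-0-abelianGroup using (∙-cancelʳ)
open import Data.Fin.Properties using (fromℕ<-cong)
open import Data.Product using (_×_; _,_; proj₁; proj₂)
open import Data.Sum using (_⊎_; inj₁; inj₂)
open import Data.Empty using (⊥-elim)
open import Relation.Nullary using (yes; no)
open import Relation.Binary.PropositionalEquality
  using (_≡_; refl; sym; trans; cong; cong₂; subst; module ≡-Reasoning)
open ≡-Reasoning

∸-≤-half : ∀ n s → n / 2 < s → n ℕ.∸ s ≤ n / 2
∸-≤-half n s half<s = ℕP.m≤n+o⇒m∸n≤o n s (ℕP.≤-trans n≤1+2half 1+2half≤s+half)
  where
  double : ∀ h → suc (h ℕ.* 2) ≡ suc h ℕ.+ h
  double = ℕSolver.solve-∀
  n≤1+2half : n ≤ suc (n / 2 ℕ.* 2)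
  n≤1+2half = subst (_≤ suc (n / 2 ℕ.* 2)) (sym (m≡m%n+[m/n]*n n 2))
    (ℕP.+-monoˡ-≤ (n / 2 ℕ.* 2) (ℕP.≤-pred (m%n<n n 2)))
  1+2half≤s+half : suc (n / 2 ℕ.* 2) ≤ s ℕ.+ n / 2
  1+2half≤s+half = subst (_≤ s ℕ.+ n / 2) (sym (double (n / 2))) (ℕP.+-monoˡ-≤ (n / 2) half<s)

sumℕ-cong : ∀ n {f g : ℕ → ℤ} → (∀ i → f i ≡ g i) → sumℕ n f ≡ sumℕ n g
sumℕ-cong zero    f≡g = refl
sumℕ-cong (suc n) f≡g = cong₂ _+_ (sumℕ-cong n f≡g) (f≡g n)

sumℕ-cong-< : ∀ n {f g : ℕ → ℤ} → (∀ i → i < n → f i ≡ g i) → sumℕ n f ≡ sumℕ n g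
sumℕ-cong-< zero    f≡g = refl
sumℕ-cong-< (suc n) f≡g = cong₂ _+_ (sumℕ-cong-< n (λ i i<n → f≡g i (ℕP.m≤n⇒m≤1+n i<n))) (f≡g n ℕP.≤-refl)

sumℕ-const : ∀ n c → sumℕ n (λ _ → c) ≡ + n * c
sumℕ-const zero    c = sym (ℤP.*-zeroˡ c)
sumℕ-const (suc n) c = begin
  sumℕ n (λ _ → c) + c  ≡⟨ cong (_+ c) (sumℕ-const n c) ⟩
  + n * c + c           ≡⟨ ℤP.+-comm (+ n * c) c ⟩
  c + + n * c           ≡⟨ ℤP.suc-* (+ n) c ⟨
  + suc n * c           ∎

sumℕ-distrib-+ : ∀ n (f g : ℕ → ℤ) → sumℕ n (λ i → f i + g i) ≡ sumℕ n f + sumℕ n g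
sumℕ-distrib-+ zero    f g = refl
sumℕ-distrib-+ (suc n) f g = begin
  sumℕ n (λ i → f i + g i) + (f n + g n)    ≡⟨ cong (_+ (f n + g n)) (sumℕ-distrib-+ n f g) ⟩
  sumℕ n f + sumℕ n g + (f n + g n)         ≡⟨ shuffle (sumℕ n f) (sumℕ n g) (f n) (g n) ⟩
  sumℕ n f + f n + (sumℕ n g + g n)         ∎
  where
  shuffle : ∀ w x y z → w + x + (y + z) ≡ w + y + (x + z)
  shuffle = solve-∀

*-distribˡ-sumℕ : ∀ n c (f : ℕ → ℤ) → c * sumℕ n f ≡ sumℕ n (λ i → c * f i)
*-distribˡ-sumℕ zero    c f = ℤP.*-zeroʳ c
*-distribˡ-sumℕ (suc n) c f = begin
  c * (sumℕ n f + f n)        ≡⟨ ℤP.*-distribˡ-+ c (sumℕ n f) (f n) ⟩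
  c * sumℕ n f + c * f n      ≡⟨ cong (_+ c * f n) (*-distribˡ-sumℕ n c f) ⟩
  sumℕ n (λ i → c * f i) + c * f n  ∎

*-distribʳ-sumℕ : ∀ n c (f : ℕ → ℤ) → sumℕ n f * c ≡ sumℕ n (λ i → f i * c)
*-distribʳ-sumℕ n c f = begin
  sumℕ n f * c             ≡⟨ ℤP.*-comm (sumℕ n f) c ⟩
  c * sumℕ n f             ≡⟨ *-distribˡ-sumℕ n c f ⟩
  sumℕ n (λ i → c * f i)   ≡⟨ sumℕ-cong n (λ i → ℤP.*-comm c (f i)) ⟩
  sumℕ n (λ i → f i * c)   ∎

sumℕ-swap : ∀ m n (k : ℕ → ℕ → ℤ) →
  sumℕ m (λ i → sumℕ n (k i)) ≡ sumℕ n (λ j → sumℕ m (λ i → k i j))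
sumℕ-swap zero    n k = trans (sym (ℤP.*-zeroʳ (+ n))) (sym (sumℕ-const n (+ 0)))
sumℕ-swap (suc m) n k = begin
  sumℕ m (λ i → sumℕ n (k i)) + sumℕ n (k m)                ≡⟨ cong (_+ sumℕ n (k m)) (sumℕ-swap m n k) ⟩
  sumℕ n (λ j → sumℕ m (λ i → k i j)) + sumℕ n (k m)        ≡⟨ sumℕ-distrib-+ n _ (k m) ⟨
  sumℕ n (λ j → sumℕ m (λ i → k i j) + k m j)                ∎

sumℕ-split : ∀ n m (g : ℕ → ℤ) → sumℕ (n ℕ.+ m) g ≡ sumℕ m g + sumℕ n (λ i → g (i ℕ.+ m))
sumℕ-split zero    m g = sym (ℤP.+-identityʳ (sumℕ m g))
sumℕ-split (suc n) m g = begin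
  sumℕ (n ℕ.+ m) g + g (n ℕ.+ m)                               ≡⟨ cong (_+ g (n ℕ.+ m)) (sumℕ-split n m g) ⟩
  sumℕ m g + sumℕ n (λ i → g (i ℕ.+ m)) + g (n ℕ.+ m)          ≡⟨ ℤP.+-assoc (sumℕ m g) _ _ ⟩
  sumℕ m g + (sumℕ n (λ i → g (i ℕ.+ m)) + g (n ℕ.+ m))        ∎

sumℕ-unfoldˡ : ∀ n (g : ℕ → ℤ) → sumℕ (suc n) g ≡ sumℕ n (λ i → g (suc i)) + g 0
sumℕ-unfoldˡ zero    g = refl
sumℕ-unfoldˡ (suc n) g = begin
  sumℕ (suc n) g + g (suc n)                          ≡⟨ cong (_+ g (suc n)) (sumℕ-unfoldˡ n g) ⟩
  sumℕ n (λ i → g (suc i)) + g 0 + g (suc n)          ≡⟨ swap₂₃ (sumℕ n (λ i → g (suc i))) (g 0) (g (suc n)) ⟩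
  sumℕ n (λ i → g (suc i)) + g (suc n) + g 0          ∎
  where
  swap₂₃ : ∀ x y z → x + y + z ≡ x + z + y
  swap₂₃ = solve-∀

sumℕ-three : ∀ (f : ℕ → ℤ) → sumℕ 3 f ≡ f 0 + f 1 + f 2
sumℕ-three f = cong (λ x → x + f 1 + f 2) (ℤP.+-identityˡ (f 0))

sumℕ-rotate : ∀ n (f : ℕ → ℤ) → (∀ k → f (k ℕ.+ n) ≡ f k) →
  ∀ s → sumℕ n (λ i → f (i ℕ.+ s)) ≡ sumℕ n f
sumℕ-rotate n f periodic zero    = sumℕ-cong n (λ i → cong f (ℕP.+-identityʳ i))
sumℕ-rotate n f periodic (suc s) = begin
  sumℕ n (λ i → f (i ℕ.+ suc s))   ≡⟨ sumℕ-cong n (λ i → cong f (ℕP.+-suc i s)) ⟩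
  sumℕ n (λ i → h (suc i))         ≡⟨ ∙-cancelʳ (h 0) _ _ wrap-around ⟩
  sumℕ n h                         ≡⟨ sumℕ-rotate n f periodic s ⟩
  sumℕ n f                         ∎
  where
  h : ℕ → ℤ
  h i = f (i ℕ.+ s)
  wrap-around : sumℕ n (λ i → h (suc i)) + h 0 ≡ sumℕ n h + h 0
  wrap-around = begin
    sumℕ n (λ i → h (suc i)) + h 0  ≡⟨ sumℕ-unfoldˡ n h ⟨
    sumℕ n h + h n                  ≡⟨ cong (λ k → sumℕ n h + f k) (ℕP.+-comm n s) ⟩
    sumℕ n h + f (s ℕ.+ n)          ≡⟨ cong (λ x → sumℕ n h + x) (periodic s) ⟩
    sumℕ n h + h 0                  ∎

strideSum : (d n : ℕ) → (ℕ → ℤ) → ℕ → ℤ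
strideSum d n g r = sumℕ n (λ t → g (r ℕ.+ t ℕ.* d))

sumℕ-strides : ∀ d n (g : ℕ → ℤ) → sumℕ (n ℕ.* d) g ≡ sumℕ d (strideSum d n g)
sumℕ-strides d zero    g = trans (sym (ℤP.*-zeroʳ (+ d))) (sym (sumℕ-const d (+ 0)))
sumℕ-strides d (suc n) g = begin
  sumℕ (d ℕ.+ n ℕ.* d) g                                        ≡⟨ sumℕ-split d (n ℕ.* d) g ⟩
  sumℕ (n ℕ.* d) g + sumℕ d (λ r → g (r ℕ.+ n ℕ.* d))           ≡⟨ cong (_+ sumℕ d (λ r → g (r ℕ.+ n ℕ.* d))) (sumℕ-strides d n g) ⟩
  sumℕ d (strideSum d n g) + sumℕ d (λ r → g (r ℕ.+ n ℕ.* d))   ≡⟨ sumℕ-distrib-+ d (strideSum d n g) _ ⟨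
  sumℕ d (strideSum d (suc n) g)                                ∎

strideSum-periodic : ∀ d n (g : ℕ → ℤ) → (∀ k → g (k ℕ.+ n ℕ.* d) ≡ g k) →
  ∀ r s → strideSum d n g (r ℕ.+ s ℕ.* d) ≡ strideSum d n g r
strideSum-periodic d n g periodic r s = begin
  sumℕ n (λ t → g (r ℕ.+ s ℕ.* d ℕ.+ t ℕ.* d))   ≡⟨ sumℕ-cong n (λ t → cong g (reassoc r s t d)) ⟩
  sumℕ n (λ t → f (t ℕ.+ s))                    ≡⟨ sumℕ-rotate n f f-periodic s ⟩
  sumℕ n f                                      ∎
  where
  f : ℕ → ℤ
  f t = g (r ℕ.+ t ℕ.* d)
  reassoc : ∀ r s t d → r ℕ.+ s ℕ.* d ℕ.+ t ℕ.* d ≡ r ℕ.+ (t ℕ.+ s) ℕ.* d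
  reassoc = ℕSolver.solve-∀
  f-periodic : ∀ k → f (k ℕ.+ n) ≡ f k
  f-periodic k = begin
    g (r ℕ.+ (k ℕ.+ n) ℕ.* d)        ≡⟨ cong (λ x → g (r ℕ.+ x)) (ℕP.*-distribʳ-+ d k n) ⟩
    g (r ℕ.+ (k ℕ.* d ℕ.+ n ℕ.* d))  ≡⟨ cong g (ℕP.+-assoc r (k ℕ.* d) (n ℕ.* d)) ⟨
    g (r ℕ.+ k ℕ.* d ℕ.+ n ℕ.* d)    ≡⟨ periodic (r ℕ.+ k ℕ.* d) ⟩
    f k                              ∎

sumℕ-periodic-weight : ∀ d n (g w : ℕ → ℤ) → (∀ r t → w (r ℕ.+ t ℕ.* d) ≡ w r) →
  sumℕ (n ℕ.* d) (λ k → g k * w k) ≡ sumℕ d (λ r → strideSum d n g r * w r)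
sumℕ-periodic-weight d n g w periodic = trans (sumℕ-strides d n (λ k → g k * w k)) (sumℕ-cong d class)
  where
  class : ∀ r → strideSum d n (λ k → g k * w k) r ≡ strideSum d n g r * w r
  class r = begin
    sumℕ n (λ t → g (r ℕ.+ t ℕ.* d) * w (r ℕ.+ t ℕ.* d))   ≡⟨ sumℕ-cong n (λ t → cong (g (r ℕ.+ t ℕ.* d) *_) (periodic r t)) ⟩
    sumℕ n (λ t → g (r ℕ.+ t ℕ.* d) * w r)                 ≡⟨ *-distribʳ-sumℕ n (w r) _ ⟨
    strideSum d n g r * w r                               ∎

sq-±1 : ∀ {x} → x ≡ + 1 ⊎ x ≡ - (+ 1) → sq x ≡ + 1
sq-±1 (inj₁ refl) = refl
sq-±1 (inj₂ refl) = refl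

-- (x − z) + (y − z)ζ = x + yζ + zζ², as ζ² = −1 − ζ.
absSq-residues : ∀ x y z → + 2 * absSq (x - z , y - z) ≡ + 3 * (sq x + sq y + sq z) - sq (x + y + z)
absSq-residues = expanded
  where
  expanded : ∀ x y z → + 2 * ((x - z) * (x - z) - (x - z) * (y - z) + (y - z) * (y - z))
                     ≡ + 3 * (x * x + y * y + z * z) - (x + y + z) * (x + y + z)
  expanded = solve-∀

ζ^-periodic : ∀ r t → ζ^ (r ℕ.+ t ℕ.* 3) ≡ ζ^ r
ζ^-periodic r t rewrite [m+kn]%n≡m%n r t 3 {{_}} = refl

sumᴱ-components : ∀ n (F : ℕ → Eis) → sumᴱ n F ≡ (sumℕ n (λ k → proj₁ (F k)) , sumℕ n (λ k → proj₂ (F k)))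
sumᴱ-components zero    F = refl
sumᴱ-components (suc n) F = cong (_+ᴱ F n) (sumᴱ-components n F)

classSquareSum : ∀ ℓ .{{_ : NonZero ℓ}} → Seq ℓ → ℕ → ℤ
classSquareSum ℓ a m = sq (classSum ℓ a m 1) + sq (classSum ℓ a m 2) + sq (classSum ℓ a m 3)

module _ {ℓ : ℕ} .{{_ : NonZero ℓ}} (a : Seq ℓ) where

  private
    A : ℕ → ℤ
    A = at ℓ a

  at-periodic : ∀ k → A (k ℕ.+ ℓ) ≡ A k
  at-periodic k = cong a (fromℕ<-cong _ _ ([m+n]%n≡m%n k ℓ) _ _)

  PAF-reflect : ∀ s → s ≤ ℓ → PAF ℓ a s ≡ PAF ℓ a (ℓ ℕ.∸ s)
  PAF-reflect s s≤ℓ = trans (sumℕ-cong ℓ lag-swap) (sumℕ-rotate ℓ f f-periodic s)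
    where
    u : ℕ
    u = ℓ ℕ.∸ s
    f : ℕ → ℤ
    f i = A i * A (i ℕ.+ u)
    swap-last : ∀ k l u → k ℕ.+ l ℕ.+ u ≡ k ℕ.+ u ℕ.+ l
    swap-last = ℕSolver.solve-∀
    f-periodic : ∀ k → f (k ℕ.+ ℓ) ≡ f k
    f-periodic k = cong₂ _*_ (at-periodic k)
      (trans (cong A (swap-last k ℓ u)) (at-periodic (k ℕ.+ u)))
    lag-swap : ∀ i → A i * A (i ℕ.+ s) ≡ f (i ℕ.+ s)
    lag-swap i = begin
      A i * A (i ℕ.+ s)                    ≡⟨ ℤP.*-comm (A i) (A (i ℕ.+ s)) ⟩
      A (i ℕ.+ s) * A i                    ≡⟨ cong (A (i ℕ.+ s) *_) (at-periodic i) ⟨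
      A (i ℕ.+ s) * A (i ℕ.+ ℓ)            ≡⟨ cong (λ j → A (i ℕ.+ s) * A (i ℕ.+ j)) (ℕP.m+[n∸m]≡n s≤ℓ) ⟨
      A (i ℕ.+ s) * A (i ℕ.+ (s ℕ.+ u))    ≡⟨ cong (λ j → A (i ℕ.+ s) * A j) (ℕP.+-assoc i s u) ⟨
      f (i ℕ.+ s)                          ∎

  PAF-zero : IsPM1 a → PAF ℓ a 0 ≡ + ℓ
  PAF-zero ±1 = begin
    sumℕ ℓ (λ i → A i * A (i ℕ.+ 0))  ≡⟨ sumℕ-cong ℓ (λ i → trans (cong (λ j → A i * A j) (ℕP.+-identityʳ i)) (sq-±1 (±1 _))) ⟩
    sumℕ ℓ (λ _ → + 1)                ≡⟨ sumℕ-const ℓ (+ 1) ⟩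
    + ℓ * + 1                         ≡⟨ ℤP.*-identityʳ (+ ℓ) ⟩
    + ℓ                               ∎

  sumℕ-PAF-multiples : ∀ d n → ℓ ≡ n ℕ.* d →
    sumℕ n (λ t → PAF ℓ a (t ℕ.* d)) ≡ sumℕ d (λ r → sq (strideSum d n A r))
  sumℕ-PAF-multiples d n ℓ≡ = begin
    sumℕ n (λ t → sumℕ ℓ (λ i → A i * A (i ℕ.+ t ℕ.* d)))   ≡⟨ sumℕ-swap n ℓ _ ⟩
    sumℕ ℓ (λ i → sumℕ n (λ t → A i * A (i ℕ.+ t ℕ.* d)))   ≡⟨ sumℕ-cong ℓ (λ i → *-distribˡ-sumℕ n (A i) _) ⟨
    sumℕ ℓ (λ i → A i * G i)                                 ≡⟨ cong (λ L → sumℕ L (λ i → A i * G i)) ℓ≡ ⟩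
    sumℕ (n ℕ.* d) (λ i → A i * G i)                         ≡⟨ sumℕ-periodic-weight d n A G (strideSum-periodic d n A A-periodic) ⟩
    sumℕ d (λ r → sq (G r))                                  ∎
    where
    G : ℕ → ℤ
    G = strideSum d n A
    A-periodic : ∀ k → A (k ℕ.+ n ℕ.* d) ≡ A k
    A-periodic k = subst (λ L → A (k ℕ.+ L) ≡ A k) ℓ≡ (at-periodic k)

  module _ (m : ℕ) (ℓ≡ : ℓ ≡ m ℕ.* 3) where

    private
      G : ℕ → ℤ
      G = strideSum 3 m A

    total-strides : total ℓ a ≡ G 0 + G 1 + G 2
    total-strides = trans (cong (λ L → sumℕ L A) ℓ≡) (trans (sumℕ-strides 3 m A) (sumℕ-three G))

    DFTm-strides : DFTm ℓ a ≡ (G 0 - G 2 , G 1 - G 2)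
    DFTm-strides = begin
      sumᴱ ℓ (λ k → scale (A k) (ζ^ k))                                      ≡⟨ cong (λ L → sumᴱ L (λ k → scale (A k) (ζ^ k))) ℓ≡ ⟩
      sumᴱ (m ℕ.* 3) (λ k → scale (A k) (ζ^ k))                              ≡⟨ sumᴱ-components (m ℕ.* 3) _ ⟩
      (sumℕ (m ℕ.* 3) (λ k → A k * proj₁ (ζ^ k)) , sumℕ (m ℕ.* 3) (λ k → A k * proj₂ (ζ^ k)))
        ≡⟨ cong₂ _,_ (sumℕ-periodic-weight 3 m A _ (λ r t → cong proj₁ (ζ^-periodic r t)))
                     (sumℕ-periodic-weight 3 m A _ (λ r t → cong proj₂ (ζ^-periodic r t))) ⟩
      (sumℕ 3 (λ r → G r * proj₁ (ζ^ r)) , sumℕ 3 (λ r → G r * proj₂ (ζ^ r)))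
        ≡⟨ cong₂ _,_ (re-part (G 0) (G 1) (G 2)) (im-part (G 0) (G 1) (G 2)) ⟩
      (G 0 - G 2 , G 1 - G 2)                                                ∎
      where
      re-part : ∀ x y z → + 0 + x * + 1 + y * + 0 + z * - (+ 1) ≡ x - z
      re-part = solve-∀
      im-part : ∀ x y z → + 0 + x * + 0 + y * + 1 + z * - (+ 1) ≡ y - z
      im-part = solve-∀

    classSum-strideSum : ∀ r → classSum ℓ a m (suc r) ≡ G r
    classSum-strideSum r = sumℕ-cong m (λ t → cong A (index t))
      where
      index : ∀ t → 3 ℕ.* t ℕ.+ suc r ℕ.∸ 1 ≡ r ℕ.+ t ℕ.* 3
      index t = trans (cong (ℕ._∸ 1) (ℕP.+-suc (3 ℕ.* t) r))
        (trans (ℕP.+-comm (3 ℕ.* t) r) (cong (r ℕ.+_) (ℕP.*-comm 3 t)))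

    classSquareSum-strides : classSquareSum ℓ a m ≡ sq (G 0) + sq (G 1) + sq (G 2)
    classSquareSum-strides = cong₂ _+_ (cong₂ _+_ (cong sq (classSum-strideSum 0)) (cong sq (classSum-strideSum 1)))
      (cong sq (classSum-strideSum 2))

    PSDm-classSquareSum : total ℓ a ≡ + 1 ⊎ total ℓ a ≡ - (+ 1) → + 2 * PSDm ℓ a ≡ + 3 * classSquareSum ℓ a m - + 1
    PSDm-classSquareSum total≡±1 = begin
      + 2 * absSq (DFTm ℓ a)                                          ≡⟨ cong (λ z → + 2 * absSq z) DFTm-strides ⟩
      + 2 * absSq (G 0 - G 2 , G 1 - G 2)                             ≡⟨ absSq-residues (G 0) (G 1) (G 2) ⟩
      + 3 * (sq (G 0) + sq (G 1) + sq (G 2)) - sq (G 0 + G 1 + G 2)   ≡⟨ cong₂ (λ x y → + 3 * x - y) (sym classSquareSum-strides) total² ⟩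
      + 3 * classSquareSum ℓ a m - + 1                                ∎
      where
      total² : sq (G 0 + G 1 + G 2) ≡ + 1
      total² = trans (cong sq (sym total-strides)) (sq-±1 total≡±1)

    classSquareSum-PAF : classSquareSum ℓ a m ≡ sumℕ m (λ t → PAF ℓ a (t ℕ.* 3))
    classSquareSum-PAF = begin
      classSquareSum ℓ a m                  ≡⟨ classSquareSum-strides ⟩
      sq (G 0) + sq (G 1) + sq (G 2)        ≡⟨ sumℕ-three (λ r → sq (G r)) ⟨
      sumℕ 3 (λ r → sq (G r))               ≡⟨ sumℕ-PAF-multiples 3 m ℓ≡ ⟨
      sumℕ m (λ t → PAF ℓ a (t ℕ.* 3))      ∎

LegendrePair-PAF : ∀ {ℓ} .{{_ : NonZero ℓ}} {a b : Seq ℓ} → LegendrePair ℓ a b →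
  ∀ s → 1 ≤ s → s < ℓ → PAF ℓ a s + PAF ℓ b s ≡ - (+ 2)
LegendrePair-PAF {ℓ} {a = a} {b} (_ , _ , _ , _ , paf) s 1≤s s<ℓ with s ≤? ℓ / 2
... | yes s≤half = paf s 1≤s s≤half
... | no  s≰half = begin
  PAF ℓ a s + PAF ℓ b s                  ≡⟨ cong₂ _+_ (PAF-reflect a s (ℕP.<⇒≤ s<ℓ)) (PAF-reflect b s (ℕP.<⇒≤ s<ℓ)) ⟩
  PAF ℓ a (ℓ ℕ.∸ s) + PAF ℓ b (ℓ ℕ.∸ s)  ≡⟨ paf (ℓ ℕ.∸ s) (ℕP.m<n⇒0<n∸m s<ℓ) (∸-≤-half ℓ s (ℕP.≰⇒> s≰half)) ⟩
  - (+ 2)                                ∎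

LegendrePair-classSquareSums : ∀ {ℓ} .{{_ : NonZero ℓ}} {a b : Seq ℓ} → LegendrePair ℓ a b →
  ∀ n → ℓ ≡ suc n ℕ.* 3 → classSquareSum ℓ a (suc n) + classSquareSum ℓ b (suc n) ≡ + 4 * + suc n + + 2
LegendrePair-classSquareSums {ℓ} {a} {b} LP@(±1ᵃ , ±1ᵇ , _) n ℓ≡ = begin
  classSquareSum ℓ a (suc n) + classSquareSum ℓ b (suc n)  ≡⟨ cong₂ _+_ (classSquareSum-PAF a (suc n) ℓ≡) (classSquareSum-PAF b (suc n) ℓ≡) ⟩
  sumℕ (suc n) (λ t → PAF ℓ a (t ℕ.* 3)) + sumℕ (suc n) (λ t → PAF ℓ b (t ℕ.* 3))  ≡⟨ sumℕ-distrib-+ (suc n) _ _ ⟨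
  sumℕ (suc n) h                                           ≡⟨ sumℕ-unfoldˡ n h ⟩
  sumℕ n (λ t → h (suc t)) + h 0                           ≡⟨ cong₂ _+_ off-peak peak ⟩
  + n * - (+ 2) + (+ ℓ + + ℓ)                              ≡⟨ cong (λ L → + n * - (+ 2) + (+ L + + L)) ℓ≡ ⟩
  + n * - (+ 2) + (+ (suc n ℕ.* 3) + + (suc n ℕ.* 3))      ≡⟨ cong (λ L → + n * - (+ 2) + (L + L)) (ℤP.pos-* (suc n) 3) ⟩
  + n * - (+ 2) + (+ suc n * + 3 + + suc n * + 3)          ≡⟨ count (+ n) ⟩
  + 4 * + suc n + + 2                                      ∎
  where
  h : ℕ → ℤ
  h t = PAF ℓ a (t ℕ.* 3) + PAF ℓ b (t ℕ.* 3)
  off-peak : sumℕ n (λ t → h (suc t)) ≡ + n * - (+ 2)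
  off-peak = trans (sumℕ-cong-< n (λ t t<n → LegendrePair-PAF LP (suc t ℕ.* 3) (ℕ.s≤s ℕ.z≤n) (lag<ℓ t<n)))
                   (sumℕ-const n (- (+ 2)))
    where
    lag<ℓ : ∀ {t} → t < n → suc t ℕ.* 3 < ℓ
    lag<ℓ {t} t<n = subst (suc t ℕ.* 3 <_) (sym ℓ≡) (ℕP.*-monoˡ-< 3 (ℕ.s≤s t<n))
  peak : h 0 ≡ + ℓ + + ℓ
  peak = cong₂ _+_ (PAF-zero a ±1ᵃ) (PAF-zero b ±1ᵇ)
  count : ∀ x → x * - (+ 2) + ((+ 1 + x) * + 3 + (+ 1 + x) * + 3) ≡ + 4 * (+ 1 + x) + + 2
  count = solve-∀

corollary1 : (ℓ : ℕ) .{{_ : NonZero ℓ}} → Odd ℓ → 3 ∣ ℓ →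
    (a b : Seq ℓ) → LegendrePair ℓ a b →
    (+ 2 * PSDm ℓ a ≡ + 3 * (sq (classSum ℓ a (ℓ / 3) 1) + sq (classSum ℓ a (ℓ / 3) 2) + sq (classSum ℓ a (ℓ / 3) 3)) - + 1)
    × (+ 2 * PSDm ℓ b ≡ + 3 * (sq (classSum ℓ b (ℓ / 3) 1) + sq (classSum ℓ b (ℓ / 3) 2) + sq (classSum ℓ b (ℓ / 3) 3)) - + 1)
    × (sq (classSum ℓ a (ℓ / 3) 1) + sq (classSum ℓ a (ℓ / 3) 2) + sq (classSum ℓ a (ℓ / 3) 3)
       + sq (classSum ℓ b (ℓ / 3) 1) + sq (classSum ℓ b (ℓ / 3) 2) + sq (classSum ℓ b (ℓ / 3) 3)
       ≡ + 4 * + (ℓ / 3) + + 2)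
corollary1 ℓ _ (divides zero ℓ≡0) a b _ = ⊥-elim (ℕ.≢-nonZero⁻¹ ℓ ℓ≡0)
corollary1 ℓ _ (divides (suc n) ℓ≡) a b LP@(_ , _ , totalᵃ≡totalᵇ , totalᵃ≡±1 , _)
  rewrite trans (cong (_/ 3) ℓ≡) (m*n/n≡m (suc n) 3) =
    PSDm-classSquareSum a (suc n) ℓ≡ totalᵃ≡±1 ,
    PSDm-classSquareSum b (suc n) ℓ≡ totalᵇ≡±1 ,
    trans (regroup (classSquareSum ℓ a (suc n)) (sqᵇ 1) (sqᵇ 2) (sqᵇ 3)) (LegendrePair-classSquareSums LP n ℓ≡)
  where
  totalᵇ≡±1 : total ℓ b ≡ + 1 ⊎ total ℓ b ≡ - (+ 1)
  totalᵇ≡±1 = subst (λ t → t ≡ + 1 ⊎ t ≡ - (+ 1)) totalᵃ≡totalᵇ totalᵃ≡±1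
  sqᵇ : ℕ → ℤ
  sqᵇ j = sq (classSum ℓ b (suc n) j)
  regroup : ∀ x y₁ y₂ y₃ → x + y₁ + y₂ + y₃ ≡ x + (y₁ + y₂ + y₃)
  regroup = solve-∀
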